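{- Let $F(t)=\sum_{n\ge 0}\sum_{k\ge 0}k!\,S(n-k,k)\,t^{n}$ as a formal power series. Then $$F(t)=\sum_{k\ge 0}\prod_{j=1}^k\frac{jt^2}{1-jt}=\sum_{i\ge 0}\frac{t^i}{(1-it)(1+t)^{i+1}}.$$
   Context: $S(m,k)$ denotes the Stirling number of the second kind (number of partitions of an $m$-element set into $k$ blocks), with $S(0,0)=1$ and $S(m,k)=0$ whenever $m<0$ or the value is otherwise undefined. Empty products equal $1$. -}

module Defs where

open import Data.Nat as ℕ using (ℕ; zero; suc; _≟_)

open import Data.Integer using (ℤ; +_; -_; _+_; _*_; _^_)
open import Relation.Nullary using (yes; no)

S : ℕ → ℕ → ℕ
S zero    zero    = 1
S zero    (suc k) = 0
S (suc m) zero    = 0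
S (suc m) (suc k) = suc k ℕ.* S m (suc k) ℕ.+ S m k

sumTo : ℕ → (ℕ → ℤ) → ℤ
sumTo zero    f = f zero
sumTo (suc n) f = sumTo n f + f (suc n)

sumToℕ : ℕ → (ℕ → ℕ) → ℕ
sumToℕ zero    f = f zero
sumToℕ (suc n) f = sumToℕ n f ℕ.+ f (suc n)

FPS : Set
FPS = ℕ → ℤ

_·_ : FPS → FPS → FPS
(a · b) n = sumTo n (λ i → a i * b (n ℕ.∸ i))

infixl 7 _·_

const : ℤ → FPS
const c zero    = c
const c (suc n) = + 0

one : FPS
one = const (+ 1)

tpow : ℕ → FPS
tpow i n with n ≟ i
... | yes _ = + 1
... | no  _ = + 0

-- 1/(1 - c t) = Σ_n c^n t^n
geom : ℤ → FPS
geom c n = c ^ n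

pow : FPS → ℕ → FPS
pow a zero    = one
pow a (suc k) = pow a k · a

prodTerm : ℕ → FPS
prodTerm zero    = one
prodTerm (suc k) = prodTerm k · (const (+ suc k) · tpow 2 · geom (+ suc k))

-- t^i / ((1 - i t) (1 + t)^{i+1}),  with 1/(1+t) = geom (-1)
thirdTerm : ℕ → FPS
thirdTerm i = tpow i · geom (+ i) · pow (geom (- + 1)) (suc i)

-- F(t) = Σ_n Σ_{k} k! S(n-k,k) t^n ; for k > n the summand is 0 by convention
F : FPS
F n = + sumToℕ n (λ k → (k ℕ.!) ℕ.* S (n ℕ.∸ k) k)

-- Both identities are checked coefficientwise, with k! S(m,k) read as the number of
-- surjections from an m-set onto a k-set.
--
-- Product form: the k-th product P_k satisfies (1 - (k+1)t) P_{k+1} = (k+1) t² P_k, so its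
-- coefficients obey the recurrence of the surjection numbers, k! S(n-k,k) being the n-th one.
--
-- Partial-fraction form: the coefficient of t^k in t^i/(1+t)^(i+1) is (-1)^(k-i) C(k,i),
-- so the n-th coefficient of the i-th term is Σ_k (-1)^(k-i) C(k,i) i^(n-k); summing over i
-- first, the classical formula Σ_i (-1)^(k-i) C(k,i) i^m = k! S(m,k) gives F.
module Submission where

open import Defs
open import Data.Nat using (ℕ; _≤_)
open import Data.Product using (_×_)
open import Relation.Binary.PropositionalEquality using (_≡_)

open import Data.Nat as ℕ using (zero; suc; _<_; z≤n; s≤s; _∸_; _!)
import Data.Nat.Properties as ℕₚ
import Data.Nat.Tactic.RingSolver as ℕ-Solver
open import Data.Integer using (ℤ; +_; -_; _+_; _*_; _-_; _^_)
open import Data.Integer.Properties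
open import Data.Integer.Tactic.RingSolver using (solve-∀)
open import Data.Empty using (⊥-elim)
open import Data.Product using (_,_)
open import Data.Sum using (inj₁; inj₂)
open import Relation.Binary.PropositionalEquality
  using (_≢_; refl; sym; trans; cong; cong₂; module ≡-Reasoning)
open import Relation.Nullary using (yes; no)
open ≡-Reasoning

sumTo-cong : ∀ n {f g : ℕ → ℤ} → (∀ i → i ≤ n → f i ≡ g i) → sumTo n f ≡ sumTo n g
sumTo-cong zero    f≗g = f≗g 0 z≤n
sumTo-cong (suc n) f≗g =
  cong₂ _+_ (sumTo-cong n (λ i i≤n → f≗g i (ℕₚ.m≤n⇒m≤1+n i≤n))) (f≗g (suc n) ℕₚ.≤-refl)

sumTo-+ : ∀ n (f g : ℕ → ℤ) → sumTo n (λ i → f i + g i) ≡ sumTo n f + sumTo n g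
sumTo-+ zero    f g = refl
sumTo-+ (suc n) f g = trans (cong (_+ (f (suc n) + g (suc n))) (sumTo-+ n f g))
                            (+-interchange (sumTo n f) (sumTo n g) (f (suc n)) (g (suc n)))
  where
  +-interchange : ∀ a b c d → a + b + (c + d) ≡ a + c + (b + d)
  +-interchange = solve-∀

sumTo-*ˡ : ∀ n c (f : ℕ → ℤ) → sumTo n (λ i → c * f i) ≡ c * sumTo n f
sumTo-*ˡ zero    c f = refl
sumTo-*ˡ (suc n) c f = trans (cong (_+ c * f (suc n)) (sumTo-*ˡ n c f))
                             (sym (*-distribˡ-+ c (sumTo n f) (f (suc n))))

sumTo-zero : ∀ n (f : ℕ → ℤ) → (∀ i → i ≤ n → f i ≡ + 0) → sumTo n f ≡ + 0
sumTo-zero n f f≗0 = trans (sumTo-cong n f≗0) (sumTo-const-zero n)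
  where
  sumTo-const-zero : ∀ n → sumTo n (λ _ → + 0) ≡ + 0
  sumTo-const-zero zero    = refl
  sumTo-const-zero (suc n) = cong (_+ + 0) (sumTo-const-zero n)

sumTo-single : ∀ n j (f : ℕ → ℤ) → j ≤ n → (∀ i → i ≤ n → i ≢ j → f i ≡ + 0) →
               sumTo n f ≡ f j
sumTo-single zero    .zero f z≤n _   = refl
sumTo-single (suc n) j     f j≤1+n f≗0 with j ℕ.≟ suc n
... | yes refl = trans (cong (_+ f (suc n)) (sumTo-zero n f below)) (+-identityˡ _)
  where
  below : ∀ i → i ≤ n → f i ≡ + 0
  below i i≤n = f≗0 i (ℕₚ.m≤n⇒m≤1+n i≤n) (ℕₚ.<⇒≢ (s≤s i≤n))
... | no j≢1+n = trans
  (cong₂ _+_ (sumTo-single n j f (ℕₚ.≤-pred (ℕₚ.≤∧≢⇒< j≤1+n j≢1+n))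
                           (λ i i≤n → f≗0 i (ℕₚ.m≤n⇒m≤1+n i≤n)))
             (f≗0 (suc n) ℕₚ.≤-refl (λ 1+n≡j → j≢1+n (sym 1+n≡j))))
  (+-identityʳ _)

sumTo-suc : ∀ n (f : ℕ → ℤ) → sumTo (suc n) f ≡ f 0 + sumTo n (λ i → f (suc i))
sumTo-suc zero    f = refl
sumTo-suc (suc n) f = trans (cong (_+ f (suc (suc n))) (sumTo-suc n f))
                            (+-assoc (f 0) (sumTo n (λ i → f (suc i))) (f (suc (suc n))))

sumTo-swap : ∀ M n (f : ℕ → ℕ → ℤ) →
             sumTo M (λ i → sumTo n (f i)) ≡ sumTo n (λ j → sumTo M (λ i → f i j))
sumTo-swap zero    n f = refl
sumTo-swap (suc M) n f = trans (cong (_+ sumTo n (f (suc M))) (sumTo-swap M n f))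
                               (sym (sumTo-+ n (λ j → sumTo M (λ i → f i j)) (f (suc M))))

sumTo-reverse : ∀ n (f : ℕ → ℤ) → sumTo n f ≡ sumTo n (λ i → f (n ∸ i))
sumTo-reverse zero    f = refl
sumTo-reverse (suc n) f = begin
  sumTo (suc n) f                                 ≡⟨ sumTo-suc n f ⟩
  f 0 + sumTo n (λ i → f (suc i))                 ≡⟨ cong (λ s → f 0 + s) (sumTo-reverse n (λ i → f (suc i))) ⟩
  f 0 + sumTo n (λ i → f (suc (n ∸ i)))           ≡⟨ +-comm (f 0) _ ⟩
  sumTo n (λ i → f (suc (n ∸ i))) + f 0           ≡⟨ cong₂ _+_ (sumTo-cong n (λ i i≤n → cong f (sym (ℕₚ.+-∸-assoc 1 i≤n))))
                                                               (cong f (sym (ℕₚ.n∸n≡0 n))) ⟩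
  sumTo (suc n) (λ i → f (suc n ∸ i))             ∎

sumTo-telescope : ∀ n (f : ℕ → ℤ) → sumTo n (λ i → f i - f (suc i)) ≡ f 0 - f (suc n)
sumTo-telescope zero    f = refl
sumTo-telescope (suc n) f = trans (cong (_+ (f (suc n) - f (suc (suc n)))) (sumTo-telescope n f))
                                  (cancel (f 0) (f (suc n)) (f (suc (suc n))))
  where
  cancel : ∀ a b c → a - b + (b - c) ≡ a - c
  cancel = solve-∀

sumTo-extend : ∀ n N (f : ℕ → ℤ) → n ≤ N → (∀ k → n < k → f k ≡ + 0) → sumTo N f ≡ sumTo n f
sumTo-extend n N f n≤N f≗0 with ℕₚ.m≤n⇒m<n∨m≡n n≤N
... | inj₂ refl = refl
sumTo-extend n (suc N) f _ f≗0 | inj₁ (s≤s n≤N) =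
  trans (cong₂ _+_ (sumTo-extend n N f n≤N f≗0) (f≗0 (suc N) (s≤s n≤N))) (+-identityʳ _)

+sumToℕ : ∀ n f → + sumToℕ n f ≡ sumTo n (λ k → + f k)
+sumToℕ zero    f = refl
+sumToℕ (suc n) f = trans (pos-+ (sumToℕ n f) (f (suc n))) (cong (_+ + f (suc n)) (+sumToℕ n f))

·-cong : ∀ {a a′ b b′ : FPS} → (∀ i → a i ≡ a′ i) → (∀ i → b i ≡ b′ i) → ∀ n → (a · b) n ≡ (a′ · b′) n
·-cong a≗a′ b≗b′ n = sumTo-cong n (λ i _ → cong₂ _*_ (a≗a′ i) (b≗b′ (n ∸ i)))

·-comm : ∀ (a b : FPS) n → (a · b) n ≡ (b · a) n
·-comm a b n = trans (sumTo-reverse n _) (sumTo-cong n λ i i≤n →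
  trans (cong (λ j → a (n ∸ i) * b j) (ℕₚ.m∸[m∸n]≡n i≤n)) (*-comm (a (n ∸ i)) (b i)))

·-suc : ∀ (a b : FPS) n → (a · b) (suc n) ≡ sumTo n (λ i → a i * b (suc (n ∸ i))) + a (suc n) * b 0
·-suc a b n = cong₂ _+_ (sumTo-cong n (λ i i≤n → cong (λ j → a i * b j) (ℕₚ.+-∸-assoc 1 i≤n)))
                        (cong (λ j → a (suc n) * b j) (ℕₚ.n∸n≡0 n))

·-scaledʳ : ∀ (a b b′ : FPS) c → (∀ i → b i ≡ c * b′ i) → ∀ n → (a · b) n ≡ c * (a · b′) n
·-scaledʳ a b b′ c b≗cb′ n =
  trans (sumTo-cong n (λ i _ → trans (cong (a i *_) (b≗cb′ (n ∸ i))) (*-left-swap (a i) c _)))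
        (sumTo-*ˡ n c _)
  where
  *-left-swap : ∀ x y z → x * (y * z) ≡ y * (x * z)
  *-left-swap = solve-∀

·-geom-suc : ∀ (a : FPS) c n → (a · geom c) (suc n) ≡ c * (a · geom c) n + a (suc n)
·-geom-suc a c n = begin
  (a · geom c) (suc n)                                          ≡⟨ ·-suc a (geom c) n ⟩
  sumTo n (λ i → a i * (c * geom c (n ∸ i))) + a (suc n) * + 1  ≡⟨ cong₂ _+_ (·-scaledʳ a (λ m → c * geom c m) (geom c) c (λ _ → refl) n)
                                                                           (*-identityʳ _) ⟩
  c * (a · geom c) n + a (suc n)                                ∎

·-assoc-geom : ∀ (a b : FPS) c n → (a · (b · geom c)) n ≡ ((a · b) · geom c) n
·-assoc-geom a b c zero    = sym (*-assoc (a 0) (b 0) (+ 1))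
·-assoc-geom a b c (suc n) = begin
  (a · w) (suc n)                                                            ≡⟨ ·-suc a w n ⟩
  sumTo n (λ l → a l * w (suc (n ∸ l))) + a (suc n) * w 0                    ≡⟨ cong₂ _+_ (sumTo-cong n (λ l _ → trans (cong (a l *_) (·-geom-suc b c (n ∸ l))) (*-distribˡ-+ (a l) _ _)))
                                                                                          (cong (a (suc n) *_) (*-identityʳ (b 0))) ⟩
  sumTo n (λ l → a l * (c * w (n ∸ l)) + a l * b (suc (n ∸ l))) + a (suc n) * b 0  ≡⟨ cong (_+ a (suc n) * b 0) (sumTo-+ n _ _) ⟩
  sumTo n (λ l → a l * (c * w (n ∸ l))) + Σb + a (suc n) * b 0               ≡⟨ +-assoc (sumTo n (λ l → a l * (c * w (n ∸ l)))) Σb (a (suc n) * b 0) ⟩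
  sumTo n (λ l → a l * (c * w (n ∸ l))) + (Σb + a (suc n) * b 0)             ≡⟨ cong₂ _+_ (·-scaledʳ a (λ m → c * w m) w c (λ _ → refl) n)
                                                                                          (sym (·-suc a b n)) ⟩
  c * (a · w) n + (a · b) (suc n)                                            ≡⟨ cong (λ x → c * x + (a · b) (suc n)) (·-assoc-geom a b c n) ⟩
  c * ((a · b) · geom c) n + (a · b) (suc n)                                 ≡⟨ sym (·-geom-suc (a · b) c n) ⟩
  ((a · b) · geom c) (suc n)                                                 ∎
  where
  w : FPS
  w = b · geom c
  Σb : ℤ
  Σb = sumTo n (λ l → a l * b (suc (n ∸ l)))

·-supportedˡ : ∀ (a b : FPS) j n → (∀ i → i ≢ j → a i ≡ + 0) → j ≤ n → (a · b) n ≡ a j * b (n ∸ j)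
·-supportedˡ a b j n a≗0 j≤n =
  sumTo-single n j _ j≤n (λ i _ i≢j → cong (_* b (n ∸ i)) (a≗0 i i≢j))

·-supportedˡ-< : ∀ (a b : FPS) j n → (∀ i → i ≢ j → a i ≡ + 0) → n < j → (a · b) n ≡ + 0
·-supportedˡ-< a b j n a≗0 n<j =
  sumTo-zero n _ (λ i i≤n → cong (_* b (n ∸ i)) (a≗0 i (ℕₚ.<⇒≢ (ℕₚ.≤-<-trans i≤n n<j))))

const-off : ∀ c j → j ≢ 0 → const c j ≡ + 0
const-off c zero    j≢0 = ⊥-elim (j≢0 refl)
const-off c (suc j) _   = refl

const-· : ∀ c (a : FPS) n → (const c · a) n ≡ c * a n
const-· c a n = ·-supportedˡ (const c) a 0 n (const-off c) z≤n

tpow-diag : ∀ i → tpow i i ≡ + 1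
tpow-diag i with i ℕ.≟ i
... | yes _   = refl
... | no  i≢i = ⊥-elim (i≢i refl)

tpow-off : ∀ i j → j ≢ i → tpow i j ≡ + 0
tpow-off i j j≢i with j ℕ.≟ i
... | yes j≡i = ⊥-elim (j≢i j≡i)
... | no  _   = refl

shift : ℕ → FPS → FPS
shift zero    a k       = a k
shift (suc i) a zero    = + 0
shift (suc i) a (suc k) = shift i a k

shift-+ : ∀ j (a : FPS) b → shift j a (j ℕ.+ b) ≡ a b
shift-+ zero    a b = refl
shift-+ (suc j) a b = shift-+ j a b

shift-< : ∀ j (a : FPS) k → k < j → shift j a k ≡ + 0
shift-< (suc j) a zero    _         = refl
shift-< (suc j) a (suc k) (s≤s k<j) = shift-< j a k k<j

shift-≥ : ∀ j (a : FPS) k → j ≤ k → shift j a k ≡ a (k ∸ j)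
shift-≥ zero    a k       _         = refl
shift-≥ (suc j) a (suc k) (s≤s j≤k) = shift-≥ j a k j≤k

tpow-· : ∀ i (a : FPS) k → (tpow i · a) k ≡ shift i a k
tpow-· i a k with i ℕ.≤? k
... | yes i≤k = begin
  (tpow i · a) k       ≡⟨ ·-supportedˡ (tpow i) a i k (tpow-off i) i≤k ⟩
  tpow i i * a (k ∸ i) ≡⟨ cong (_* a (k ∸ i)) (tpow-diag i) ⟩
  + 1 * a (k ∸ i)      ≡⟨ *-identityˡ _ ⟩
  a (k ∸ i)            ≡⟨ sym (shift-≥ i a k i≤k) ⟩
  shift i a k          ∎
... | no i≰k = trans (·-supportedˡ-< (tpow i) a i k (tpow-off i) (ℕₚ.≰⇒> i≰k))
                     (sym (shift-< i a k (ℕₚ.≰⇒> i≰k)))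

·-const-tpow : ∀ (a : FPS) c j n → (a · (const c · tpow j)) n ≡ c * shift j a n
·-const-tpow a c j n = begin
  (a · (const c · tpow j)) n ≡⟨ ·-scaledʳ a (const c · tpow j) (tpow j) c (const-· c (tpow j)) n ⟩
  c * (a · tpow j) n         ≡⟨ cong (c *_) (·-comm a (tpow j) n) ⟩
  c * (tpow j · a) n         ≡⟨ cong (c *_) (tpow-· j a n) ⟩
  c * shift j a n            ∎

surj : ℕ → ℕ → ℕ
surj m k = k ! ℕ.* S m k

surj-zero-suc : ∀ k → surj 0 (suc k) ≡ 0
surj-zero-suc k = ℕₚ.*-zeroʳ (suc k !)

surj-suc-suc : ∀ m k → surj (suc m) (suc k) ≡ suc k ℕ.* (surj m (suc k) ℕ.+ surj m k)
surj-suc-suc m k = rearrange (suc k) (k !) (S m (suc k)) (S m k)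
  where
  rearrange : ∀ K f a b → K ℕ.* f ℕ.* (K ℕ.* a ℕ.+ b) ≡ K ℕ.* (K ℕ.* f ℕ.* a ℕ.+ f ℕ.* b)
  rearrange = ℕ-Solver.solve-∀

surj-∸-vanish : ∀ n k → n < k → surj (n ∸ k) k ≡ 0
surj-∸-vanish n (suc k) n<1+k rewrite ℕₚ.m≤n⇒m∸n≡0 (ℕₚ.<⇒≤ n<1+k) = surj-zero-suc k

-- The truncated subtraction makes both sides vanish together when n < k.
surj-∸-suc : ∀ n k → surj (suc n ∸ k) (suc k) ≡ suc k ℕ.* (surj (n ∸ k) (suc k) ℕ.+ surj (n ∸ k) k)
surj-∸-suc n k with k ℕ.≤? n
... | yes k≤n rewrite ℕₚ.+-∸-assoc 1 k≤n = surj-suc-suc (n ∸ k) k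
... | no  k≰n = begin
  surj (suc n ∸ k) (suc k)                              ≡⟨ cong (λ m → surj m (suc k)) (ℕₚ.m≤n⇒m∸n≡0 n<k) ⟩
  surj 0 (suc k)                                        ≡⟨ surj-zero-suc k ⟩
  0                                                     ≡⟨ sym (ℕₚ.*-zeroʳ (suc k)) ⟩
  suc k ℕ.* 0                                           ≡⟨ cong (suc k ℕ.*_) (sym (cong₂ ℕ._+_ surj-∸-suc-vanish (surj-∸-vanish n k n<k))) ⟩
  suc k ℕ.* (surj (n ∸ k) (suc k) ℕ.+ surj (n ∸ k) k) ∎
  where
  n<k : n < k
  n<k = ℕₚ.≰⇒> k≰n
  surj-∸-suc-vanish : surj (n ∸ k) (suc k) ≡ 0
  surj-∸-suc-vanish = trans (cong (λ m → surj m (suc k)) (ℕₚ.m≤n⇒m∸n≡0 (ℕₚ.<⇒≤ n<k))) (surj-zero-suc k)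

+surj-∸-suc : ∀ n k → + surj (suc n ∸ k) (suc k) ≡ + suc k * + surj (n ∸ k) (suc k) + + suc k * + surj (n ∸ k) k
+surj-∸-suc n k = begin
  + surj (suc n ∸ k) (suc k)                                    ≡⟨ cong +_ (surj-∸-suc n k) ⟩
  + (suc k ℕ.* (surj (n ∸ k) (suc k) ℕ.+ surj (n ∸ k) k))      ≡⟨ pos-* (suc k) _ ⟩
  + suc k * + (surj (n ∸ k) (suc k) ℕ.+ surj (n ∸ k) k)        ≡⟨ cong (+ suc k *_) (pos-+ (surj (n ∸ k) (suc k)) _) ⟩
  + suc k * (+ surj (n ∸ k) (suc k) + + surj (n ∸ k) k)        ≡⟨ *-distribˡ-+ (+ suc k) (+ surj (n ∸ k) (suc k)) (+ surj (n ∸ k) k) ⟩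
  + suc k * + surj (n ∸ k) (suc k) + + suc k * + surj (n ∸ k) k ∎

prodTerm-coeff : ∀ k n → prodTerm k n ≡ + surj (n ∸ k) k
prodTerm-coeff zero    zero    = refl
prodTerm-coeff zero    (suc n) = refl
prodTerm-coeff (suc k) n       = trans (·-assoc-geom P (const c · tpow 2) c n) (coeff n)
  where
  P : FPS
  P = prodTerm k
  c : ℤ
  c = + suc k
  b : FPS
  b = P · (const c · tpow 2)
  coeff : ∀ n → (b · geom c) n ≡ + surj (n ∸ suc k) (suc k)
  coeff zero = begin
    b 0 * + 1      ≡⟨ *-identityʳ (b 0) ⟩
    b 0            ≡⟨ ·-const-tpow P c 2 0 ⟩
    c * + 0        ≡⟨ *-zeroʳ c ⟩
    + 0            ≡⟨ cong +_ (sym (surj-zero-suc k)) ⟩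
    + surj 0 (suc k) ∎
  coeff (suc zero) = begin
    (b · geom c) 1                 ≡⟨ ·-geom-suc b c 0 ⟩
    c * (b · geom c) 0 + b 1       ≡⟨ cong₂ _+_ (cong (c *_) (trans (coeff 0) (cong +_ (surj-zero-suc k)))) (·-const-tpow P c 2 1) ⟩
    c * + 0 + c * + 0              ≡⟨ cong₂ _+_ (*-zeroʳ c) (*-zeroʳ c) ⟩
    + 0                            ≡⟨ cong +_ (sym (trans (cong (λ m → surj m (suc k)) (ℕₚ.0∸n≡0 k)) (surj-zero-suc k))) ⟩
    + surj (0 ∸ k) (suc k)         ∎
  coeff (suc (suc m)) = begin
    (b · geom c) (suc (suc m))                           ≡⟨ ·-geom-suc b c (suc m) ⟩
    c * (b · geom c) (suc m) + b (suc (suc m))           ≡⟨ cong₂ _+_ (cong (c *_) (coeff (suc m)))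
                                                                      (trans (·-const-tpow P c 2 (suc (suc m))) (cong (c *_) (prodTerm-coeff k m))) ⟩
    c * + surj (m ∸ k) (suc k) + c * + surj (m ∸ k) k    ≡⟨ sym (+surj-∸-suc m k) ⟩
    + surj (suc m ∸ k) (suc k)                           ∎

negBinom : ℕ → FPS
negBinom p = pow (geom (- + 1)) p

negBinom-zero : ∀ p → negBinom p 0 ≡ + 1
negBinom-zero zero    = refl
negBinom-zero (suc p) = trans (*-identityʳ (negBinom p 0)) (negBinom-zero p)

negBinom-suc : ∀ p b → negBinom (suc p) (suc b) ≡ - negBinom (suc p) b + negBinom p (suc b)
negBinom-suc p b = trans (·-geom-suc (negBinom p) (- + 1) b) (cong (_+ negBinom p (suc b)) (-1*i≡-i (negBinom (suc p) b)))

*-distribˡ-neg-+ : ∀ s x y → s * (- x + y) ≡ - (s * x) + s * y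
*-distribˡ-neg-+ = solve-∀

negBinom-index-ratio  : ∀ b i → + i * negBinom (suc i) b ≡ + (i ℕ.+ b) * negBinom i b
negBinom-degree-ratio : ∀ b p → + suc b * negBinom p (suc b) ≡ - (+ (p ℕ.+ b) * negBinom p b)

negBinom-index-ratio zero i = begin
  + i * negBinom (suc i) 0     ≡⟨ cong (+ i *_) (negBinom-zero (suc i)) ⟩
  + i * + 1                    ≡⟨ cong₂ _*_ (cong +_ (sym (ℕₚ.+-identityʳ i))) (sym (negBinom-zero i)) ⟩
  + (i ℕ.+ 0) * negBinom i 0   ∎
negBinom-index-ratio (suc b) i = begin
  + i * negBinom (suc i) (suc b)     ≡⟨ cong (+ i *_) (negBinom-suc i b) ⟩
  + i * (- x + y)                    ≡⟨ *-distribˡ-neg-+ (+ i) x y ⟩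
  - (+ i * x) + + i * y              ≡⟨ cong (λ z → - z + + i * y) (negBinom-index-ratio b i) ⟩
  - (+ (i ℕ.+ b) * negBinom i b) + + i * y ≡⟨ cong (_+ + i * y) (sym (negBinom-degree-ratio b i)) ⟩
  + suc b * y + + i * y              ≡⟨ sym (*-distribʳ-+ y (+ suc b) (+ i)) ⟩
  (+ suc b + + i) * y                ≡⟨ cong (_* y) (sym (pos-+ (suc b) i)) ⟩
  + (suc b ℕ.+ i) * y                ≡⟨ cong (λ z → + z * y) (ℕₚ.+-comm (suc b) i) ⟩
  + (i ℕ.+ suc b) * y                ∎
  where
  x : ℤ
  x = negBinom (suc i) b
  y : ℤ
  y = negBinom i (suc b)

negBinom-degree-ratio b zero = trans (*-zeroʳ (+ suc b)) (sym (cong -_ (+b*one b)))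
  where
  +b*one : ∀ b → + b * one b ≡ + 0
  +b*one zero    = refl
  +b*one (suc b) = *-zeroʳ (+ suc b)
negBinom-degree-ratio b (suc p) = begin
  + suc b * negBinom (suc p) (suc b)          ≡⟨ cong (+ suc b *_) (negBinom-suc p b) ⟩
  + suc b * (- x + negBinom p (suc b))        ≡⟨ *-distribˡ-neg-+ (+ suc b) x (negBinom p (suc b)) ⟩
  - (+ suc b * x) + + suc b * negBinom p (suc b) ≡⟨ cong (λ z → - (+ suc b * x) + z) (negBinom-degree-ratio b p) ⟩
  - (+ suc b * x) + - (+ (p ℕ.+ b) * negBinom p b) ≡⟨ cong (λ z → - (+ suc b * x) + - z) (sym (negBinom-index-ratio b p)) ⟩
  - (+ suc b * x) + - (+ p * x)               ≡⟨ neg-distribʳ (+ suc b) (+ p) x ⟩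
  - ((+ suc b + + p) * x)                     ≡⟨ cong (λ z → - (z * x)) (sym (pos-+ (suc b) p)) ⟩
  - (+ (suc b ℕ.+ p) * x)                     ≡⟨ cong (λ z → - (+ z * x)) (trans (ℕₚ.+-comm (suc b) p) (ℕₚ.+-suc p b)) ⟩
  - (+ (suc p ℕ.+ b) * x)                     ∎
  where
  x : ℤ
  x = negBinom (suc p) b
  neg-distribʳ : ∀ s q x → - (s * x) + - (q * x) ≡ - ((s + q) * x)
  neg-distribʳ = solve-∀

shift-negBinom-suc : ∀ j p k →
  shift j (negBinom (suc p)) k ≡ - shift (suc j) (negBinom (suc p)) k + shift j (negBinom p) k
shift-negBinom-suc zero    p zero    = trans (negBinom-zero (suc p)) (sym (trans (+-identityˡ _) (negBinom-zero p)))
shift-negBinom-suc zero    p (suc k) = negBinom-suc p k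
shift-negBinom-suc (suc j) p zero    = refl
shift-negBinom-suc (suc j) p (suc k) = shift-negBinom-suc j p k

signedBinom : ℕ → ℕ → ℤ
signedBinom i = shift i (negBinom (suc i))

signedBinom-zero-suc : ∀ k → signedBinom 0 (suc k) ≡ - signedBinom 0 k
signedBinom-zero-suc k = trans (negBinom-suc 0 k) (+-identityʳ _)

signedBinom-suc-suc : ∀ j k → signedBinom (suc j) (suc k) ≡ - signedBinom (suc j) k + signedBinom j k
signedBinom-suc-suc j = shift-negBinom-suc j (suc j)

signedBinom-absorb : ∀ j k → + suc j * signedBinom (suc j) (suc k) ≡ + suc k * signedBinom j k
signedBinom-absorb j k with j ℕ.≤? k
... | yes j≤k with ℕₚ.m≤n⇒∃[o]m+o≡n j≤k
... | b , refl = begin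
  + suc j * signedBinom (suc j) (suc (j ℕ.+ b)) ≡⟨ cong (+ suc j *_) (shift-+ j (negBinom (suc (suc j))) b) ⟩
  + suc j * negBinom (suc (suc j)) b            ≡⟨ negBinom-index-ratio b (suc j) ⟩
  + suc (j ℕ.+ b) * negBinom (suc j) b          ≡⟨ cong (+ suc (j ℕ.+ b) *_) (sym (shift-+ j (negBinom (suc j)) b)) ⟩
  + suc (j ℕ.+ b) * signedBinom j (j ℕ.+ b)     ∎
signedBinom-absorb j k | no j≰k = begin
  + suc j * signedBinom (suc j) (suc k) ≡⟨ cong (+ suc j *_) (shift-< j _ k k<j) ⟩
  + suc j * + 0                         ≡⟨ *-zeroʳ (+ suc j) ⟩
  + 0                                   ≡⟨ sym (*-zeroʳ (+ suc k)) ⟩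
  + suc k * + 0                         ≡⟨ cong (+ suc k *_) (sym (shift-< j _ k k<j)) ⟩
  + suc k * signedBinom j k             ∎
  where
  k<j : k < j
  k<j = ℕₚ.≰⇒> j≰k

signedBinom-weight-zero : ∀ i → + i * signedBinom i 0 ≡ + 0
signedBinom-weight-zero zero    = refl
signedBinom-weight-zero (suc i) = *-zeroʳ (+ suc i)

signedBinom-weight : ∀ i k → + i * signedBinom i (suc k) ≡ + suc k * (signedBinom i (suc k) + signedBinom i k)
signedBinom-weight zero k = sym (begin
  + suc k * (signedBinom 0 (suc k) + signedBinom 0 k) ≡⟨ cong (λ x → + suc k * (x + signedBinom 0 k)) (signedBinom-zero-suc k) ⟩
  + suc k * (- signedBinom 0 k + signedBinom 0 k)     ≡⟨ cong (+ suc k *_) (+-inverseˡ (signedBinom 0 k)) ⟩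
  + suc k * + 0                                       ≡⟨ *-zeroʳ (+ suc k) ⟩
  + 0                                                 ∎)
signedBinom-weight (suc j) k = begin
  + suc j * signedBinom (suc j) (suc k)   ≡⟨ signedBinom-absorb j k ⟩
  + suc k * signedBinom j k               ≡⟨ cong (+ suc k *_) (sym (trans (cong (_+ signedBinom (suc j) k) (signedBinom-suc-suc j k))
                                                                             (cancel (signedBinom (suc j) k) (signedBinom j k)))) ⟩
  + suc k * (signedBinom (suc j) (suc k) + signedBinom (suc j) k) ∎
  where
  cancel : ∀ a b → - a + b + a ≡ b
  cancel = solve-∀

signedBinom-row-sum-suc : ∀ N k → k < N → sumTo N (λ i → signedBinom i (suc k)) ≡ + 0
signedBinom-row-sum-suc (suc N) k (s≤s k≤N) = begin
  sumTo (suc N) (λ i → signedBinom i (suc k))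
    ≡⟨ sumTo-suc N (λ i → signedBinom i (suc k)) ⟩
  signedBinom 0 (suc k) + sumTo N (λ i → signedBinom (suc i) (suc k))
    ≡⟨ cong₂ _+_ (signedBinom-zero-suc k)
                 (sumTo-cong N (λ i _ → trans (signedBinom-suc-suc i k) (+-comm (- signedBinom (suc i) k) (signedBinom i k)))) ⟩
  - signedBinom 0 k + sumTo N (λ i → signedBinom i k - signedBinom (suc i) k)
    ≡⟨ cong (λ s → - signedBinom 0 k + s) (sumTo-telescope N (λ i → signedBinom i k)) ⟩
  - signedBinom 0 k + (signedBinom 0 k - signedBinom (suc N) k)
    ≡⟨ cancel (signedBinom 0 k) (signedBinom (suc N) k) ⟩
  - signedBinom (suc N) k
    ≡⟨ cong -_ (shift-< (suc N) (negBinom (suc (suc N))) k (s≤s k≤N)) ⟩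
  + 0 ∎
  where
  cancel : ∀ a b → - a + (a - b) ≡ - b
  cancel = solve-∀

*-swap-assoc : ∀ a b x → a * (b * x) ≡ b * a * x
*-swap-assoc = solve-∀

signedBinom-moment : ∀ N m k → k ≤ N → sumTo N (λ i → signedBinom i k * (+ i) ^ m) ≡ + surj m k
signedBinom-moment N zero zero _ =
  trans (sumTo-single N 0 _ z≤n off-zero) (trans (*-identityʳ (signedBinom 0 0)) (negBinom-zero 1))
  where
  off-zero : ∀ i → i ≤ N → i ≢ 0 → signedBinom i 0 * + 1 ≡ + 0
  off-zero zero    _ i≢0 = ⊥-elim (i≢0 refl)
  off-zero (suc i) _ _   = refl
signedBinom-moment N zero (suc k) k<N = begin
  sumTo N (λ i → signedBinom i (suc k) * + 1) ≡⟨ sumTo-cong N (λ i _ → *-identityʳ (signedBinom i (suc k))) ⟩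
  sumTo N (λ i → signedBinom i (suc k))       ≡⟨ signedBinom-row-sum-suc N k k<N ⟩
  + 0                                         ≡⟨ cong +_ (sym (surj-zero-suc k)) ⟩
  + surj 0 (suc k)                            ∎
signedBinom-moment N (suc m) zero _ = sumTo-zero N _ λ i _ →
  trans (*-swap-assoc (signedBinom i 0) (+ i) ((+ i) ^ m))
        (cong (_* (+ i) ^ m) (signedBinom-weight-zero i))
signedBinom-moment N (suc m) (suc k) k<N = begin
  sumTo N (λ i → signedBinom i K * (+ i * (+ i) ^ m))
    ≡⟨ sumTo-cong N (λ i _ → trans (*-swap-assoc (signedBinom i K) (+ i) ((+ i) ^ m))
                                   (trans (cong (_* (+ i) ^ m) (signedBinom-weight i k))
                                          (distrib (+ K) (signedBinom i K) (signedBinom i k) ((+ i) ^ m)))) ⟩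
  sumTo N (λ i → + K * (signedBinom i K * (+ i) ^ m + signedBinom i k * (+ i) ^ m))
    ≡⟨ sumTo-*ˡ N (+ K) _ ⟩
  + K * sumTo N (λ i → signedBinom i K * (+ i) ^ m + signedBinom i k * (+ i) ^ m)
    ≡⟨ cong (+ K *_) (sumTo-+ N (λ i → signedBinom i K * (+ i) ^ m) (λ i → signedBinom i k * (+ i) ^ m)) ⟩
  + K * (sumTo N (λ i → signedBinom i K * (+ i) ^ m) + sumTo N (λ i → signedBinom i k * (+ i) ^ m))
    ≡⟨ cong₂ (λ a b → + K * (a + b)) (signedBinom-moment N m K k<N) (signedBinom-moment N m k (ℕₚ.<⇒≤ k<N)) ⟩
  + K * (+ surj m K + + surj m k)
    ≡⟨ cong (+ K *_) (sym (pos-+ (surj m K) (surj m k))) ⟩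
  + K * + (surj m K ℕ.+ surj m k)
    ≡⟨ sym (pos-* K (surj m K ℕ.+ surj m k)) ⟩
  + (K ℕ.* (surj m K ℕ.+ surj m k))
    ≡⟨ cong +_ (sym (surj-suc-suc m k)) ⟩
  + surj (suc m) K ∎
  where
  K : ℕ
  K = suc k
  distrib : ∀ c a b x → c * (a + b) * x ≡ c * (a * x + b * x)
  distrib = solve-∀

thirdTerm-coeff : ∀ i n → thirdTerm i n ≡ sumTo n (λ k → signedBinom i k * (+ i) ^ (n ∸ k))
thirdTerm-coeff i n = begin
  ((tpow i · geom (+ i)) · negBinom (suc i)) n ≡⟨ ·-comm (tpow i · geom (+ i)) (negBinom (suc i)) n ⟩
  (negBinom (suc i) · (tpow i · geom (+ i))) n ≡⟨ ·-assoc-geom (negBinom (suc i)) (tpow i) (+ i) n ⟩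
  ((negBinom (suc i) · tpow i) · geom (+ i)) n ≡⟨ ·-cong {b = geom (+ i)} (·-comm (negBinom (suc i)) (tpow i)) (λ _ → refl) n ⟩
  ((tpow i · negBinom (suc i)) · geom (+ i)) n ≡⟨ sumTo-cong n (λ k _ → cong (_* (+ i) ^ (n ∸ k)) (tpow-· i (negBinom (suc i)) k)) ⟩
  sumTo n (λ k → signedBinom i k * (+ i) ^ (n ∸ k)) ∎

F≡sumTo-surj : ∀ n → F n ≡ sumTo n (λ k → + surj (n ∸ k) k)
F≡sumTo-surj n = +sumToℕ n (λ k → surj (n ∸ k) k)

F≡sumTo-prodTerm : ∀ n N → n ≤ N → F n ≡ sumTo N (λ k → prodTerm k n)
F≡sumTo-prodTerm n N n≤N = begin
  F n                                      ≡⟨ F≡sumTo-surj n ⟩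
  sumTo n (λ k → + surj (n ∸ k) k)         ≡⟨ sumTo-extend n N _ n≤N (λ k n<k → cong +_ (surj-∸-vanish n k n<k)) ⟨
  sumTo N (λ k → + surj (n ∸ k) k)         ≡⟨ sumTo-cong N (λ k _ → prodTerm-coeff k n) ⟨
  sumTo N (λ k → prodTerm k n)             ∎

F≡sumTo-thirdTerm : ∀ n N → n ≤ N → F n ≡ sumTo N (λ i → thirdTerm i n)
F≡sumTo-thirdTerm n N n≤N = begin
  F n                                                             ≡⟨ F≡sumTo-surj n ⟩
  sumTo n (λ k → + surj (n ∸ k) k)                                ≡⟨ sumTo-cong n (λ k k≤n → signedBinom-moment N (n ∸ k) k (ℕₚ.≤-trans k≤n n≤N)) ⟨
  sumTo n (λ k → sumTo N (λ i → signedBinom i k * (+ i) ^ (n ∸ k))) ≡⟨ sumTo-swap N n (λ i k → signedBinom i k * (+ i) ^ (n ∸ k)) ⟨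
  sumTo N (λ i → sumTo n (λ k → signedBinom i k * (+ i) ^ (n ∸ k))) ≡⟨ sumTo-cong N (λ i _ → thirdTerm-coeff i n) ⟨
  sumTo N (λ i → thirdTerm i n)                                   ∎

proposition4p1 : (n N : ℕ) → n ≤ N →
    (F n ≡ sumTo N (λ k → prodTerm k n)) × (F n ≡ sumTo N (λ i → thirdTerm i n))
proposition4p1 n N n≤N = F≡sumTo-prodTerm n N n≤N , F≡sumTo-thirdTerm n N n≤N
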